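{- Let $G$ be a finite abelian group of even order $n$ and let $\mathcal{B}=(B_1,\dots,B_t)$, $t\geq2$, be an independent tuple of largest sum-free sets of $G$. Then each atom of $\mathcal{B}$ has size $n/2^t$, and there is a bijection $B\mapsto I_B$ from the set of largest sum-free sets $B$ of $G$ with $B\subseteq\bigcup_{i=1}^t B_i$ onto the set of non-empty subsets of $\{1,\dots,t\}$, satisfying $I_{B_i}=\{i\}$ for all $i$, such that for every such $B$ and every $\boldsymbol{\varepsilon}=(\varepsilon_1,\dots,\varepsilon_t)\in\{0,1\}^t$, the atom $\mathcal{B}(\boldsymbol{\varepsilon})$ is contained in $B$ if and only if $\sum_{i\in I_B}\varepsilon_i$ is odd.
   Context: A subset of an abelian group is sum-free if it contains no (not necessarily distinct) elements $a,b,c$ with $a+b=c$; a largest sum-free set is a sum-free subset of maximum size. For a largest sum-free set $B$ write $B^1=B$, $B^0=G\setminus B$; for $\mathcal{B}=(B_1,\dots,B_t)$ and $\boldsymbol{\varepsilon}\in\{0,1\}^t$ the atom is $\mathcal{B}(\boldsymbol{\varepsilon})=\bigcap_{i=1}^t B_i^{\varepsilon_i}$. The tuple is independent if no $B_i$ is contained in the union of the remaining $B_j$'s. (The bijection with $I_{B_i}=\{i\}$ is what the paper calls the canonical correspondence.) -}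

module Defs where

open import Data.Nat using (ℕ; _≤_; _%_)
open import Data.Bool using (Bool; if_then_else_)
open import Data.Fin using (Fin)
open import Data.Fin.Subset using (Subset; _∈_; _∉_; ∣_∣; ∁; ⋂; ⋃)
open import Data.List using (map; allFin)
open import Data.Product using (∃; _×_)
open import Relation.Binary.PropositionalEquality using (_≡_; _≢_)
open import Relation.Nullary using (¬_)

-- A finite abelian group of order n is represented (up to isomorphism)
-- by a group structure on Fin n; the law-record is the library's IsAbelianGroup.

module _ {n : ℕ} (_+_ : Fin n → Fin n → Fin n) where

  SumFree : Subset n → Set
  SumFree B = ∀ a b → a ∈ B → b ∈ B → (a + b) ∉ B

  LargestSumFree : Subset n → Set
  LargestSumFree B = SumFree B × (∀ C → SumFree C → ∣ C ∣ ≤ ∣ B ∣)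

module _ {n t : ℕ} (B : Fin t → Subset n) where

  UnionAll : Subset n
  UnionAll = ⋃ (map B (allFin t))

  power : Bool → Subset n → Subset n
  power e X = if e then X else ∁ X

  atom : (Fin t → Bool) → Subset n
  atom ε = ⋂ (map (λ i → power (ε i) (B i)) (allFin t))

  Independent : Set
  Independent = ∀ i → ¬ (∀ x → x ∈ B i → ∃ λ j → j ≢ i × x ∈ B j)

Odd : ℕ → Set
Odd k = k % 2 ≡ 1

module Submission where

-- The largest sum-free sets of a finite abelian group G of even order n are exactly the
-- supports of the nonzero homomorphisms χ : G → ℤ/2, encoded as Boolean functions with
-- χ (x ∙ y) = χ x xor χ y. A sum-free B has |B| ≤ n/2, since B b misses B for b ∈ B; the
-- support of such a χ has n/2 elements; and when |B| = n/2 every translation by an element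
-- of B exchanges B and its complement, which makes B a character. A nonzero character
-- exists: pairing x with x⁻¹ yields an element of order 2, so doubling is not onto, and a
-- proper subgroup containing all doubles can be enlarged until it has index 2.
--
-- Independence of B₁, …, B_t gives dual elements x_i with x_i ∈ B_j iff i = j. Translation
-- by x_i changes only the i-th coordinate, so all 2^t atoms have the same size. A character
-- ψ supported in ⋃ B_i is determined by the values ψ x_i, because y differs from the sum of
-- the x_i with y ∈ B_i by an element outside every B_i. Hence B ↦ I_B = {i : x_i ∈ B} is the
-- required bijection, and B contains the atom 𝓑(ε) exactly when Σ_{i ∈ I_B} ε_i is odd.

open import Algebra.Bundles using (AbelianGroup; CommutativeRing)
open import Algebra.Core using (Op₁; Op₂)
import Algebra.Properties.CommutativeMonoid.Sum as Summation
import Algebra.Properties.CommutativeSemigroup as CommutativeSemigroupProperties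
import Algebra.Properties.Group as GroupProperties
open import Algebra.Structures using (IsAbelianGroup)
open import Data.Bool using (Bool; true; false; not; _∧_; _∨_; _xor_; if_then_else_)
open import Data.Bool.Properties
  using ( _≟_; T-≡; ⇔→≡; ¬-not; not-¬; not-involutive; ∨-zeroʳ; ∧-zeroʳ; ∧-identityʳ; ∧-comm
        ; xor-comm; xor-same; xor-identityʳ; ∧-distribˡ-xor; xor-∧-commutativeRing)
open import Data.Empty using (⊥-elim)
open import Data.Fin using (Fin; zero; suc; toℕ; punchIn; punchOut)
open import Data.Fin.Permutation using (permutation)
import Data.Fin.Properties as Fin
open import Data.Fin.Properties
  using (toℕ-injective; any?; all?; ¬∀⟶∃¬; injective⇒≤; punchOut-injective; punchInᵢ≢i)
open import Data.Fin.Subset using (Subset; _∈_; _⊆_; _∩_; ∣_∣; ⁅_⁆; Nonempty; ⋃; ⋂)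
open import Data.Fin.Subset.Properties
  using ( _∈?_; x∈⁅x⁆; x∈⁅y⁆⇒x≡y; ∉⊥; ∈⊤; x∈p∪q⁻; x∈p∪q⁺; x∈p∩q⁻; x∈p∩q⁺
        ; x∈∁p⇒x∉p; x∉p⇒x∈∁p)
open import Data.List using (List; []; _∷_; allFin)
import Data.List as List
open import Data.List.Properties using (length-tabulate)
open import Data.List.Relation.Unary.All using (All; []; _∷_)
import Data.List.Relation.Unary.All.Properties as All
open import Data.List.Relation.Unary.AllPairs using ([]; _∷_)
open import Data.List.Relation.Unary.Any using (Any; here; there)
import Data.List.Relation.Unary.Any.Properties as Any
open import Data.List.Relation.Unary.Unique.Propositional using (Unique)
open import Data.List.Relation.Unary.Unique.Propositional.Properties using (allFin⁺)
open import Data.Nat using (ℕ; zero; suc; _+_; _*_; _^_; _%_; _≤_; _<_; _<ᵇ_; _≡ᵇ_; z≤n; s≤s)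
open import Data.Nat.Divisibility using (_∣_; divides; ∣m+n∣m⇒∣n; ∣1⇒≡1)
open import Data.Nat.Properties hiding (_≟_)
open import Data.Product using (Σ; ∃; _×_; _,_; proj₁; proj₂)
open import Data.Sum using (_⊎_; inj₁; inj₂)
open import Data.Vec using ([]; _∷_; lookup; tabulate)
open import Data.Vec.Properties
  using ( lookup∘tabulate; tabulate∘lookup; tabulate-cong; lookup-map; lookup-zipWith; lookup-replicate
        ; []=⇒lookup; lookup⇒[]=)
open import Defs
open import Function using (id; _∘_; _⇔_; mk⇔; Equivalence)
open import Function.Construct.Composition using (_⇔-∘_)
open import Function.Construct.Symmetry using (⇔-sym)
open import Function.Definitions using (Injective)
open import Level using (0ℓ)
open import Relation.Binary.PropositionalEquality
open import Relation.Nullary using (¬_; yes; no; does)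
open import Relation.Nullary.Decidable using (dec-true; dec-false; ¬?; _×-dec_; _→-dec_; decidable-stable)

private
  variable
    m : ℕ

module ℕΣ = Summation +-0-commutativeMonoid
module ⊕Σ = Summation (CommutativeRing.+-commutativeMonoid xor-∧-commutativeRing)

m+m≤n+n⇒m≤n : ∀ {m n} → m + m ≤ n + n → m ≤ n
m+m≤n+n⇒m≤n {m} {n} m+m≤n+n with m ≤? n
... | yes m≤n = m≤n
... | no m≰n = ⊥-elim (<⇒≱ (+-mono-< (≰⇒> m≰n) (≰⇒> m≰n)) m+m≤n+n)

∨≡true⁻ : ∀ a b → a ∨ b ≡ true → a ≡ true ⊎ b ≡ true
∨≡true⁻ true b _ = inj₁ refl
∨≡true⁻ false b b≡true = inj₂ b≡true

∨≡true⁺ˡ : ∀ {a} b → a ≡ true → a ∨ b ≡ true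
∨≡true⁺ˡ b a≡true = cong (_∨ b) a≡true

∨≡true⁺ʳ : ∀ a {b} → b ≡ true → a ∨ b ≡ true
∨≡true⁺ʳ a b≡true = trans (cong (a ∨_) b≡true) (∨-zeroʳ a)

∧≡true⁻ʳ : ∀ a {b} → a ∧ b ≡ true → b ≡ true
∧≡true⁻ʳ true b≡true = b≡true

contraposeᵇ : ∀ {a b} → (a ≡ true → b ≡ true) → b ≡ false → a ≡ false
contraposeᵇ {false} a⇒b b≡false = refl
contraposeᵇ {true} a⇒b b≡false = trans (sym (a⇒b refl)) b≡false

xor-cancelʳ : ∀ a b → (a xor b) xor b ≡ a
xor-cancelʳ true true = refl
xor-cancelʳ true false = refl
xor-cancelʳ false true = refl
xor-cancelʳ false false = refl

count : (Fin m → Bool) → ℕ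
count f = ℕΣ.sum (λ x → if f x then 1 else 0)

count-cong : {f g : Fin m → Bool} → (∀ x → f x ≡ g x) → count f ≡ count g
count-cong f≗g = ℕΣ.sum-cong-≗ (λ x → cong (if_then 1 else 0) (f≗g x))

count-∘-inverse : (f : Fin m → Bool) (σ τ : Fin m → Fin m)
  → (∀ x → σ (τ x) ≡ x) → (∀ x → τ (σ x) ≡ x) → count (f ∘ σ) ≡ count f
count-∘-inverse f σ τ στ τσ = sym (ℕΣ.sum-permute _ (permutation σ τ στ τσ))

count-split : (f g : Fin m → Bool)
  → count f ≡ count (λ x → f x ∧ g x) + count (λ x → f x ∧ not (g x))
count-split f g = trans (ℕΣ.sum-cong-≗ (λ x → split (f x) (g x)))
  (ℕΣ.∑-distrib-+ (λ x → if f x ∧ g x then 1 else 0) (λ x → if f x ∧ not (g x) then 1 else 0))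
  where
  split : ∀ a b → (if a then 1 else 0) ≡ (if a ∧ b then 1 else 0) + (if a ∧ not b then 1 else 0)
  split true true = refl
  split true false = refl
  split false b = refl

count-true : ∀ m → count {m} (λ _ → true) ≡ m
count-true zero = refl
count-true (suc m) = cong suc (count-true m)

count-false : ∀ m → count {m} (λ _ → false) ≡ 0
count-false zero = refl
count-false (suc m) = count-false m

count-complement : (f : Fin m → Bool) → count f + count (not ∘ f) ≡ m
count-complement {m} f = trans (sym (count-split (λ _ → true) f)) (count-true m)

count-mono : (f g : Fin m → Bool) → (∀ x → f x ≡ true → g x ≡ true) → count f ≤ count g
count-mono {zero} f g f⇒g = z≤n
count-mono {suc m} f g f⇒g with f zero in fz | g zero in gz
... | true | true = s≤s (count-mono (f ∘ suc) (g ∘ suc) (f⇒g ∘ suc))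
... | true | false with () ← trans (sym (f⇒g zero fz)) gz
... | false | true = m≤n⇒m≤1+n (count-mono (f ∘ suc) (g ∘ suc) (f⇒g ∘ suc))
... | false | false = count-mono (f ∘ suc) (g ∘ suc) (f⇒g ∘ suc)

count-positive : (f : Fin m → Bool) (x : Fin m) → f x ≡ true → 0 < count f
count-positive f zero fx rewrite fx = s≤s z≤n
count-positive f (suc x) fx = ≤-trans (count-positive (f ∘ suc) x fx) (m≤n+m _ _)

count-witness : (f : Fin m → Bool) → 0 < count f → ∃ λ x → f x ≡ true
count-witness {suc m} f pos with f zero in fz
... | true = zero , fz
... | false = let x , fx = count-witness (f ∘ suc) pos in suc x , fx

count-strict-mono : (f g : Fin m → Bool) → (∀ x → f x ≡ true → g x ≡ true)
  → ∀ x → g x ≡ true → f x ≡ false → count f < count g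
count-strict-mono f g f⇒g x gx fx = begin-strict
  count f                                        ≡⟨ count-cong g∧f≗f ⟨
  count (λ y → g y ∧ f y)                        <⟨ m<m+n _ (count-positive _ x gx∧¬fx) ⟩
  count (λ y → g y ∧ f y) + count (λ y → g y ∧ not (f y)) ≡⟨ count-split g f ⟨
  count g                                        ∎
  where
  open ≤-Reasoning
  g∧f≗f : ∀ y → g y ∧ f y ≡ f y
  g∧f≗f y with f y in fy
  ... | true = trans (∧-identityʳ (g y)) (f⇒g y fy)
  ... | false = ∧-zeroʳ (g y)
  gx∧¬fx : g x ∧ not (f x) ≡ true
  gx∧¬fx rewrite gx | fx = refl

count-≤⇒≗ : (f g : Fin m → Bool) → (∀ x → f x ≡ true → g x ≡ true)
  → count g ≤ count f → ∀ x → f x ≡ g x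
count-≤⇒≗ f g f⇒g g≤f x with f x in fx | g x in gx
... | true | true = refl
... | false | false = refl
... | true | false with () ← trans (sym (f⇒g x fx)) gx
... | false | true = ⊥-elim (<⇒≱ (count-strict-mono f g f⇒g x gx fx) g≤f)

∣p∣≡count : (p : Subset m) → ∣ p ∣ ≡ count (lookup p)
∣p∣≡count [] = refl
∣p∣≡count (true ∷ p) = cong suc (∣p∣≡count p)
∣p∣≡count (false ∷ p) = ∣p∣≡count p

∣tabulate∣≡count : (f : Fin m → Bool) → ∣ tabulate f ∣ ≡ count f
∣tabulate∣≡count f = trans (∣p∣≡count (tabulate f)) (count-cong (lookup∘tabulate f))

lookup-ext : {p q : Subset m} → (∀ i → lookup p i ≡ lookup q i) → p ≡ q
lookup-ext {p = p} {q} p≗q = trans (sym (tabulate∘lookup p)) (trans (tabulate-cong p≗q) (tabulate∘lookup q))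

∈-tabulate⁺ : {f : Fin m → Bool} {x : Fin m} → f x ≡ true → x ∈ tabulate f
∈-tabulate⁺ {f = f} {x} fx = lookup⇒[]= x (tabulate f) (trans (lookup∘tabulate f x) fx)

∈-tabulate⁻ : {f : Fin m → Bool} {x : Fin m} → x ∈ tabulate f → f x ≡ true
∈-tabulate⁻ {f = f} {x} x∈ = trans (sym (lookup∘tabulate f x)) ([]=⇒lookup x∈)

isOdd : ℕ → Bool
isOdd zero = false
isOdd (suc k) = not (isOdd k)

%2≡isOdd : ∀ k → k % 2 ≡ (if isOdd k then 1 else 0)
%2≡isOdd zero = refl
%2≡isOdd (suc zero) = refl
%2≡isOdd (suc (suc k)) = trans (%2≡isOdd k) (cong (if_then 1 else 0) (sym (not-involutive (isOdd k))))

Odd⇔isOdd : ∀ k → Odd k ⇔ isOdd k ≡ true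
Odd⇔isOdd k = mk⇔ (to (isOdd k) ∘ trans (sym (%2≡isOdd k))) (trans (%2≡isOdd k) ∘ cong (if_then 1 else 0))
  where
  to : ∀ b → (if b then 1 else 0) ≡ 1 → b ≡ true
  to true _ = refl

xorSum : (Fin m → Bool) → Bool
xorSum = ⊕Σ.sum

isOdd-count : (f : Fin m → Bool) → isOdd (count f) ≡ xorSum f
isOdd-count {zero} f = refl
isOdd-count {suc m} f with f zero
... | true = cong not (isOdd-count (f ∘ suc))
... | false = isOdd-count (f ∘ suc)

xorSum-cong : {f g : Fin m → Bool} → (∀ i → f i ≡ g i) → xorSum f ≡ xorSum g
xorSum-cong = ⊕Σ.sum-cong-≗

xorSum-xor : (f g : Fin m → Bool) → xorSum (λ i → f i xor g i) ≡ xorSum f xor xorSum g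
xorSum-xor = ⊕Σ.∑-distrib-+

xorSum-witness : (f : Fin m → Bool) → xorSum f ≡ true → ∃ λ i → f i ≡ true
xorSum-witness {suc m} f odd with f zero in fz
... | true = zero , fz
... | false = let i , fi = xorSum-witness (f ∘ suc) odd in suc i , fi

xorSum-δ : (f : Fin m → Bool) (j : Fin m) → (∀ i → i ≢ j → f i ≡ false) → xorSum f ≡ f j
xorSum-δ {suc m} f j off = begin
  xorSum f                           ≡⟨ ⊕Σ.sum-remove {i = j} f ⟩
  f j xor xorSum (λ k → f (punchIn j k)) ≡⟨ cong (f j xor_) rest≡false ⟩
  f j xor false                      ≡⟨ xor-identityʳ (f j) ⟩
  f j                                ∎
  where
  open ≡-Reasoning
  rest≡false : xorSum (λ k → f (punchIn j k)) ≡ false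
  rest≡false = trans (⊕Σ.sum-cong-≗ (λ k → off (punchIn j k) (punchInᵢ≢i j k)))
                     (⊕Σ.sum-replicate-zero m)

Odd∣p∩q∣⇔ : (p q : Subset m) → Odd ∣ p ∩ q ∣ ⇔ xorSum (λ i → lookup p i ∧ lookup q i) ≡ true
Odd∣p∩q∣⇔ p q = subst (λ b → Odd ∣ p ∩ q ∣ ⇔ b ≡ true) parity (Odd⇔isOdd ∣ p ∩ q ∣)
  where
  parity : isOdd ∣ p ∩ q ∣ ≡ xorSum (λ i → lookup p i ∧ lookup q i)
  parity = trans (cong isOdd (trans (∣p∣≡count (p ∩ q)) (count-cong (λ i → lookup-zipWith _∧_ i p q))))
                 (isOdd-count (λ i → lookup p i ∧ lookup q i))

injective⇒covering : (s : Fin m → Fin m) → Injective _≡_ _≡_ s → ∀ w → ¬ (∀ y → s y ≢ w)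
injective⇒covering {suc m} s inj w misses = 1+n≰n (injective⇒≤ punchOut∘s-injective)
  where
  punchOut∘s-injective : Injective _≡_ _≡_ (λ y → punchOut (misses y ∘ sym))
  punchOut∘s-injective eq = inj (punchOut-injective (misses _ ∘ sym) (misses _ ∘ sym) eq)

collision⇒missed : (f : Fin m → Fin m) (a b : Fin m) → a ≢ b → f a ≡ f b
  → ∃ λ y → ∀ x → f x ≢ y
collision⇒missed {m} f a b a≢b fa≡fb with any? (λ y → all? (λ x → ¬? (f x Fin.≟ y)))
... | yes missed = missed
... | no ¬missed = ⊥-elim (injective⇒covering s s-injective w w-missed)
  where
  hit : ∀ y → ∃ λ x → f x ≡ y
  hit y = let x , ¬fx≢y = ¬∀⟶∃¬ m _ (λ x → ¬? (f x Fin.≟ y)) (¬missed ∘ (y ,_))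
          in x , decidable-stable (f x Fin.≟ y) ¬fx≢y
  s : Fin m → Fin m
  s y = proj₁ (hit y)
  f∘s : ∀ y → f (s y) ≡ y
  f∘s y = proj₂ (hit y)
  s-injective : Injective _≡_ _≡_ s
  s-injective {y} {z} eq = trans (sym (f∘s y)) (trans (cong f eq) (f∘s z))
  -- s (f a) = s (f b) is a single value, so it differs from a or from b
  witness : ∃ λ w → s (f a) ≢ w × f w ≡ f a
  witness with s (f a) Fin.≟ a
  ... | yes sfa≡a = b , (λ sfa≡b → a≢b (trans (sym sfa≡a) sfa≡b)) , sym fa≡fb
  ... | no sfa≢a = a , sfa≢a , refl
  w = proj₁ witness
  w-missed : ∀ y → s y ≢ w
  w-missed y sy≡w = proj₁ (proj₂ witness)
    (trans (cong s (trans (sym (proj₂ (proj₂ witness))) (trans (cong f (sym sy≡w)) (f∘s y)))) sy≡w)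

count-single : (c : Fin m) → count {m} (λ x → toℕ x ≡ᵇ toℕ c) ≡ 1
count-single {suc m} zero = cong suc (count-false m)
count-single {suc m} (suc c) = count-single c

≡ᵇ-toℕ⇔≡ : (a b : Fin m) → (toℕ a ≡ᵇ toℕ b) ≡ true ⇔ a ≡ b
≡ᵇ-toℕ⇔≡ a b = mk⇔ (toℕ-injective ∘ ≡ᵇ⇒≡ (toℕ a) (toℕ b) ∘ Equivalence.from T-≡)
                   (Equivalence.to T-≡ ∘ ≡⇒≡ᵇ (toℕ a) (toℕ b) ∘ cong toℕ)

count-involution : (σ : Fin m → Fin m) → (∀ x → σ (σ x) ≡ x)
  → let below = λ x → toℕ x <ᵇ toℕ (σ x) in
    count below + count below + count (λ x → toℕ x ≡ᵇ toℕ (σ x)) ≡ m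
count-involution {m} σ σ∘σ = begin
  count below + count below + count fixed
    ≡⟨ +-assoc (count below) _ _ ⟩
  count below + (count below + count fixed)
    ≡⟨ cong (count below +_) (cong₂ _+_ swap tie) ⟨
  count below + (count (λ x → not (below x) ∧ above x) + count (λ x → not (below x) ∧ not (above x)))
    ≡⟨ cong (count below +_) (count-split (not ∘ below) above) ⟨
  count below + count (not ∘ below)
    ≡⟨ count-complement below ⟩
  m ∎
  where
  open ≡-Reasoning
  below above fixed : Fin m → Bool
  below x = toℕ x <ᵇ toℕ (σ x)
  above x = below (σ x)
  fixed x = toℕ x ≡ᵇ toℕ (σ x)
  <ᵇ-asym : ∀ a b → not (a <ᵇ b) ∧ (b <ᵇ a) ≡ (b <ᵇ a)
  <ᵇ-asym zero zero = refl
  <ᵇ-asym zero (suc b) = refl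
  <ᵇ-asym (suc a) zero = refl
  <ᵇ-asym (suc a) (suc b) = <ᵇ-asym a b
  <ᵇ-tri : ∀ a b → not (a <ᵇ b) ∧ not (b <ᵇ a) ≡ (a ≡ᵇ b)
  <ᵇ-tri zero zero = refl
  <ᵇ-tri zero (suc b) = refl
  <ᵇ-tri (suc a) zero = refl
  <ᵇ-tri (suc a) (suc b) = <ᵇ-tri a b
  above≡ : ∀ x → above x ≡ (toℕ (σ x) <ᵇ toℕ x)
  above≡ x = cong (λ y → toℕ (σ x) <ᵇ toℕ y) (σ∘σ x)
  swap : count (λ x → not (below x) ∧ above x) ≡ count below
  swap = trans (count-cong (λ x → trans (cong (not (below x) ∧_) (above≡ x)) (<ᵇ-asym (toℕ x) (toℕ (σ x)))))
               (trans (count-cong (λ x → sym (above≡ x))) (count-∘-inverse below σ σ σ∘σ σ∘σ))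
  tie : count (λ x → not (below x) ∧ not (above x)) ≡ count fixed
  tie = count-cong (λ x → trans (cong (λ b → not (below x) ∧ not b) (above≡ x)) (<ᵇ-tri (toℕ x) (toℕ (σ x))))

involution-secondFixedPoint : (σ : Fin m → Fin m) → (∀ x → σ (σ x) ≡ x) → 2 ∣ m
  → ∀ c → σ c ≡ c → ∃ λ x → x ≢ c × σ x ≡ x
involution-secondFixedPoint {m} σ σ∘σ 2∣m c σc≡c
  with any? (λ x → ¬? (x Fin.≟ c) ×-dec (σ x Fin.≟ x))
... | yes found = found
... | no none = ⊥-elim (1+n≢n (∣1⇒≡1 (∣m+n∣m⇒∣n 2∣2k+1 2∣2k)))
  where
  k = count (λ x → toℕ x <ᵇ toℕ (σ x))
  2∣2k : 2 ∣ k + k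
  2∣2k = divides k (sym (trans (*-comm k 2) (cong (k +_) (+-identityʳ k))))
  fixed⇔c : ∀ x → x ≡ σ x ⇔ x ≡ c
  fixed⇔c x = mk⇔ (λ x≡σx → decidable-stable (x Fin.≟ c) (λ x≢c → none (x , x≢c , sym x≡σx)))
                  (λ { refl → sym σc≡c })
  fixed≗c : ∀ x → (toℕ x ≡ᵇ toℕ (σ x)) ≡ (toℕ x ≡ᵇ toℕ c)
  fixed≗c x = ⇔→≡ (⇔-sym (≡ᵇ-toℕ⇔≡ x c) ⇔-∘ (fixed⇔c x ⇔-∘ ≡ᵇ-toℕ⇔≡ x (σ x)))
  2∣2k+1 : 2 ∣ k + k + 1
  2∣2k+1 = subst (2 ∣_) (sym (trans (cong (k + k +_) (sym (trans (count-cong {m} fixed≗c) (count-single c))))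
                                    (count-involution σ σ∘σ))) 2∣m

∈⋃⁻ : ∀ {y : Fin m} (ps : List (Subset m)) → y ∈ ⋃ ps → Any (y ∈_) ps
∈⋃⁻ [] y∈⊥ = ⊥-elim (∉⊥ y∈⊥)
∈⋃⁻ (p ∷ ps) y∈ with x∈p∪q⁻ p (⋃ ps) y∈
... | inj₁ y∈p = here y∈p
... | inj₂ y∈ps = there (∈⋃⁻ ps y∈ps)

∈⋃⁺ : ∀ {y : Fin m} {ps : List (Subset m)} → Any (y ∈_) ps → y ∈ ⋃ ps
∈⋃⁺ (here y∈p) = x∈p∪q⁺ (inj₁ y∈p)
∈⋃⁺ (there y∈ps) = x∈p∪q⁺ (inj₂ (∈⋃⁺ y∈ps))

∈⋂⁻ : ∀ {y : Fin m} (ps : List (Subset m)) → y ∈ ⋂ ps → All (y ∈_) ps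
∈⋂⁻ [] _ = []
∈⋂⁻ (p ∷ ps) y∈ = let y∈p , y∈ps = x∈p∩q⁻ p (⋂ ps) y∈ in y∈p ∷ ∈⋂⁻ ps y∈ps

∈⋂⁺ : ∀ {y : Fin m} {ps : List (Subset m)} → All (y ∈_) ps → y ∈ ⋂ ps
∈⋂⁺ [] = ∈⊤
∈⋂⁺ (y∈p ∷ y∈ps) = x∈p∩q⁺ (y∈p , ∈⋂⁺ y∈ps)

module _ {t : ℕ} (B : Fin t → Subset m) where

  ∈UnionAll⁻ : ∀ {y} → y ∈ UnionAll B → ∃ λ i → y ∈ B i
  ∈UnionAll⁻ = Any.tabulate⁻ ∘ Any.map⁻ ∘ ∈⋃⁻ _

  ∈UnionAll⁺ : ∀ {y} i → y ∈ B i → y ∈ UnionAll B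
  ∈UnionAll⁺ i y∈Bi = ∈⋃⁺ (Any.map⁺ (Any.tabulate⁺ i y∈Bi))

  ∈power⇔ : ∀ e (X : Subset m) {y} → y ∈ power B e X ⇔ lookup X y ≡ e
  ∈power⇔ true X {y} = mk⇔ []=⇒lookup (lookup⇒[]= y X)
  ∈power⇔ false X {y} = mk⇔ (λ y∈∁X → ¬-not (x∈∁p⇒x∉p y∈∁X ∘ lookup⇒[]= y X))
                             (λ y∉X → x∉p⇒x∈∁p (λ y∈X → not-¬ ([]=⇒lookup y∈X) y∉X))

  ∈atom⇔ : ∀ ε {y} → y ∈ atom B ε ⇔ (∀ i → lookup (B i) y ≡ ε i)
  ∈atom⇔ ε = mk⇔
    (λ y∈ i → Equivalence.to (∈power⇔ (ε i) (B i)) (All.tabulate⁻ (All.map⁻ (∈⋂⁻ _ y∈)) i))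
    (λ agrees → ∈⋂⁺ (All.map⁺ (All.tabulate⁺ (λ i → Equivalence.from (∈power⇔ (ε i) (B i)) (agrees i)))))

  lookup-power : ∀ e (X : Subset m) y → lookup (power B e X) y ≡ (if e then lookup X y else not (lookup X y))
  lookup-power true X y = refl
  lookup-power false X y = lookup-map y not X

  lookup-power-cong : ∀ e (X : Subset m) {y z} → lookup X y ≡ lookup X z
    → lookup (power B e X) y ≡ lookup (power B e X) z
  lookup-power-cong e X {y} {z} eq = trans (lookup-power e X y)
    (trans (cong (λ b → if e then b else not b) eq) (sym (lookup-power e X z)))

  lookup-power-not : ∀ e (X : Subset m) {y z} → lookup X y ≡ not (lookup X z)
    → lookup (power B e X) y ≡ not (lookup (power B e X) z)
  lookup-power-not e X {y} {z} eq = trans (lookup-power e X y)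
    (trans (cong (λ b → if e then b else not b) eq) (trans (if-not e) (cong not (sym (lookup-power e X z)))))
    where
    if-not : ∀ e {b} → (if e then not b else not (not b)) ≡ not (if e then b else not b)
    if-not true = refl
    if-not false = refl

  independent⇒separated : Independent B → ∀ i
    → ∃ λ y → lookup (B i) y ≡ true × (∀ j → j ≢ i → lookup (B j) y ≡ false)
  independent⇒separated independent i =
    y , []=⇒lookup y∈Bi , λ j j≢i → ¬-not (λ y∈Bj → covered (λ _ → j , j≢i , lookup⇒[]= y (B j) y∈Bj))
    where
    uncovered = ¬∀⟶∃¬ m _ (λ x → x ∈? B i →-dec any? (λ j → ¬? (j Fin.≟ i) ×-dec x ∈? B j))
                          (independent i)
    y = proj₁ uncovered
    covered = proj₂ uncovered
    y∈Bi : y ∈ B i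
    y∈Bi = decidable-stable (y ∈? B i) (λ y∉Bi → covered (⊥-elim ∘ y∉Bi))

-- Characters and sum-free sets in an abelian group of order n

module SumFreeSets {n : ℕ} {op : Op₂ (Fin n)} {e : Fin n} {inv : Op₁ (Fin n)}
                   (isAbelianGroup : IsAbelianGroup _≡_ op e inv) where

  abelianGroup : AbelianGroup 0ℓ 0ℓ
  abelianGroup = record { isAbelianGroup = isAbelianGroup }

  open AbelianGroup abelianGroup
    using (_∙_; ε; _⁻¹; group; commutativeMonoid; commutativeSemigroup; assoc; comm; identityˡ; inverseʳ)

  module ∑ = Summation commutativeMonoid

  ∑ : ∀ {k} → (Fin k → Fin n) → Fin n
  ∑ = ∑.sum

  open GroupProperties group using (//-rightDividesˡ; //-rightDividesʳ; ⁻¹-involutive; ε⁻¹≈ε)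
  open CommutativeSemigroupProperties commutativeSemigroup using (interchange; xy∙z≈xz∙y)

  ∙⁻¹∙ : ∀ x g → (x ∙ g ⁻¹) ∙ g ≡ x
  ∙⁻¹∙ x g = //-rightDividesˡ g x

  ∙∙⁻¹ : ∀ x g → (x ∙ g) ∙ g ⁻¹ ≡ x
  ∙∙⁻¹ x g = //-rightDividesʳ g x

  count-∘∙ : (f : Fin n → Bool) (g : Fin n) → count (λ x → f (x ∙ g)) ≡ count f
  count-∘∙ f g = count-∘-inverse f (_∙ g) (_∙ g ⁻¹) (λ x → ∙⁻¹∙ x g) (λ x → ∙∙⁻¹ x g)

  IsCharacter : (Fin n → Bool) → Set
  IsCharacter χ = ∀ x y → χ (x ∙ y) ≡ χ x xor χ y

  record NontrivialCharacter : Set where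
    field
      χ     : Fin n → Bool
      χ-hom : IsCharacter χ
      g     : Fin n
      χg    : χ g ≡ true

  module _ {χ : Fin n → Bool} (χ-hom : IsCharacter χ) where

    character-ε : χ ε ≡ false
    character-ε = trans (cong χ (sym (identityˡ ε))) (trans (χ-hom ε ε) (xor-same (χ ε)))

    character-translate : ∀ {g} → χ g ≡ true → ∀ x → χ (x ∙ g) ≡ not (χ x)
    character-translate {g} χg x = begin
      χ (x ∙ g)      ≡⟨ χ-hom x g ⟩
      χ x xor χ g    ≡⟨ cong (χ x xor_) χg ⟩
      χ x xor true   ≡⟨ xor-comm (χ x) true ⟩
      not (χ x)      ∎
      where open ≡-Reasoning

    count-character : ∀ {g} → χ g ≡ true → count χ + count χ ≡ n
    count-character {g} χg = begin
      count χ + count χ                 ≡⟨ cong (count χ +_) (count-∘∙ χ g) ⟨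
      count χ + count (λ x → χ (x ∙ g)) ≡⟨ cong (count χ +_) (count-cong (character-translate χg)) ⟩
      count χ + count (not ∘ χ)         ≡⟨ count-complement χ ⟩
      n                                 ∎
      where open ≡-Reasoning

    character-∙⁻¹ : ∀ y g → χ (y ∙ g ⁻¹) ≡ χ y xor χ g
    character-∙⁻¹ y g = begin
      χ (y ∙ g ⁻¹)                   ≡⟨ xor-cancelʳ (χ (y ∙ g ⁻¹)) (χ g) ⟨
      (χ (y ∙ g ⁻¹) xor χ g) xor χ g ≡⟨ cong (_xor χ g) (χ-hom (y ∙ g ⁻¹) g) ⟨
      χ (y ∙ g ⁻¹ ∙ g) xor χ g       ≡⟨ cong (λ z → χ z xor χ g) (∙⁻¹∙ y g) ⟩
      χ y xor χ g                    ∎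
      where open ≡-Reasoning

    character-if : ∀ b a → χ (if b then a else ε) ≡ b ∧ χ a
    character-if true a = refl
    character-if false a = character-ε

    character-∑ : ∀ {k} (f : Fin k → Fin n) → χ (∑ f) ≡ xorSum (χ ∘ f)
    character-∑ {zero} f = character-ε
    character-∑ {suc k} f = trans (χ-hom (f zero) (∑ (f ∘ suc))) (cong (χ (f zero) xor_) (character-∑ (f ∘ suc)))

  count-halving : (f h : Fin n → Bool) (g : Fin n) → (∀ x → f (x ∙ g) ≡ f x)
    → (∀ x → h (x ∙ g) ≡ not (h x)) → count (λ x → h x ∧ f x) * 2 ≡ count f
  count-halving f h g f-invariant h-flips = begin
    count (λ x → h x ∧ f x) * 2                               ≡⟨ *-comm (count (λ x → h x ∧ f x)) 2 ⟩
    count (λ x → h x ∧ f x) + (count (λ x → h x ∧ f x) + 0)   ≡⟨ cong₂ _+_ (count-cong (λ x → ∧-comm (h x) (f x)))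
                                                                           (trans (+-identityʳ _) other-half) ⟩
    count (λ x → f x ∧ h x) + count (λ x → f x ∧ not (h x))   ≡⟨ count-split f h ⟨
    count f                                                   ∎
    where
    open ≡-Reasoning
    other-half : count (λ x → h x ∧ f x) ≡ count (λ x → f x ∧ not (h x))
    other-half = begin
      count (λ x → h x ∧ f x)                         ≡⟨ count-∘∙ _ g ⟨
      count (λ x → h (x ∙ g) ∧ f (x ∙ g))             ≡⟨ count-cong (λ x → cong₂ _∧_ (h-flips x) (f-invariant x)) ⟩
      count (λ x → not (h x) ∧ f x)                   ≡⟨ count-cong (λ x → ∧-comm (not (h x)) (f x)) ⟩
      count (λ x → f x ∧ not (h x))                   ∎

  module _ {B : Subset n} (B-sumFree : SumFree _∙_ B) where

    sumFree-translate : ∀ {b} → b ∈ B → ∀ x → lookup B (x ∙ b ⁻¹) ≡ true → lookup B x ≡ false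
    sumFree-translate {b} b∈B x x∙b⁻¹∈B with lookup B x in x∈B
    ... | false = refl
    ... | true = ⊥-elim (B-sumFree (x ∙ b ⁻¹) b (lookup⇒[]= _ B x∙b⁻¹∈B) b∈B
                   (subst (_∈ B) (sym (∙⁻¹∙ x b)) (lookup⇒[]= x B x∈B)))

    sumFree⇒count≤complement : count (lookup B) ≤ count (not ∘ lookup B)
    sumFree⇒count≤complement with any? (λ b → lookup B b ≟ true)
    ... | yes (b , b∈B) = subst (_≤ _) (count-∘∙ (lookup B) (b ⁻¹))
          (count-mono _ _ λ x x∙b⁻¹∈B → cong not (sumFree-translate (lookup⇒[]= b B b∈B) x x∙b⁻¹∈B))
    ... | no empty = count-mono _ _ (λ x x∈B → ⊥-elim (empty (x , x∈B)))

    sumFree⇒count≤half : count (lookup B) + count (lookup B) ≤ n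
    sumFree⇒count≤half = ≤-trans (+-monoʳ-≤ _ sumFree⇒count≤complement) (≤-reflexive (count-complement _))

    module _ (halfsize : n ≤ count (lookup B) + count (lookup B)) where

      private
        β : Fin n → Bool
        β = lookup B

      complement≤count : count (not ∘ β) ≤ count β
      complement≤count = +-cancelˡ-≤ (count β) _ _
        (subst (_≤ count β + count β) (sym (count-complement β)) halfsize)

      translate⁻¹-flips : ∀ {b} → β b ≡ true → ∀ x → β (x ∙ b ⁻¹) ≡ not (β x)
      translate⁻¹-flips {b} βb = count-≤⇒≗ (λ x → β (x ∙ b ⁻¹)) (not ∘ β)
        (λ x x∙b⁻¹∈B → cong not (sumFree-translate (lookup⇒[]= b B βb) x x∙b⁻¹∈B))
        (subst (count (not ∘ β) ≤_) (sym (count-∘∙ β (b ⁻¹))) complement≤count)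

      translate-flips : ∀ {b} → β b ≡ true → ∀ x → β (x ∙ b) ≡ not (β x)
      translate-flips {b} βb x = begin
        β (x ∙ b)                 ≡⟨ not-involutive _ ⟨
        not (not (β (x ∙ b)))     ≡⟨ cong not (translate⁻¹-flips βb (x ∙ b)) ⟨
        not (β (x ∙ b ∙ b ⁻¹))    ≡⟨ cong (not ∘ β) (∙∙⁻¹ x b) ⟩
        not (β x)                 ∎
        where open ≡-Reasoning

      sumFree-halfsize⇒character : IsCharacter β
      sumFree-halfsize⇒character x y with β y in βy
      ... | true = trans (translate-flips βy x) (sym (xor-comm (β x) true))
      ... | false = begin
        β (x ∙ y)                     ≡⟨ cong β (cong (x ∙_) (∙⁻¹∙ y b)) ⟨
        β (x ∙ (y ∙ b ⁻¹ ∙ b))        ≡⟨ cong β (assoc x (y ∙ b ⁻¹) b) ⟨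
        β (x ∙ (y ∙ b ⁻¹) ∙ b)        ≡⟨ translate-flips βb (x ∙ (y ∙ b ⁻¹)) ⟩
        not (β (x ∙ (y ∙ b ⁻¹)))      ≡⟨ cong not (translate-flips βy∙b⁻¹ x) ⟩
        not (not (β x))               ≡⟨ not-involutive (β x) ⟩
        β x                           ≡⟨ xor-identityʳ (β x) ⟨
        β x xor false                 ∎
        where
        open ≡-Reasoning
        nonempty : ∃ λ b → β b ≡ true
        nonempty = count-witness β (<-≤-trans (count-positive (not ∘ β) y (cong not βy)) complement≤count)
        b = proj₁ nonempty
        βb = proj₂ nonempty
        βy∙b⁻¹ : β (y ∙ b ⁻¹) ≡ true
        βy∙b⁻¹ = trans (translate⁻¹-flips βb y) (cong not βy)

  module _ {χ : Fin n → Bool} (χ-hom : IsCharacter χ) where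

    character⇒sumFree : SumFree _∙_ (tabulate χ)
    character⇒sumFree a b a∈ b∈ ab∈ with trans (sym (χ-hom a b)) (∈-tabulate⁻ ab∈)
    ... | χa⊕χb≡true rewrite ∈-tabulate⁻ a∈ | ∈-tabulate⁻ b∈ with χa⊕χb≡true
    ... | ()

    character⇒largestSumFree : ∀ {g} → χ g ≡ true → LargestSumFree _∙_ (tabulate χ)
    character⇒largestSumFree χg = character⇒sumFree , λ C C-sumFree →
      subst₂ _≤_ (sym (∣p∣≡count C)) (sym (∣tabulate∣≡count χ))
        (m+m≤n+n⇒m≤n (subst (count (lookup C) + count (lookup C) ≤_) (sym (count-character χ-hom χg))
                                 (sumFree⇒count≤half C-sumFree)))

  module _ (nontrivial : NontrivialCharacter) {B : Subset n} (B-largest : LargestSumFree _∙_ B) where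

    private
      open NontrivialCharacter nontrivial

      character≤largest : count χ ≤ count (lookup B)
      character≤largest = subst₂ _≤_ (∣tabulate∣≡count χ) (∣p∣≡count B)
        (proj₂ B-largest (tabulate χ) (character⇒sumFree χ-hom))

    largestSumFree⇒nonempty : ∃ λ b → lookup B b ≡ true
    largestSumFree⇒nonempty = count-witness (lookup B) (<-≤-trans (count-positive χ g χg) character≤largest)

    largestSumFree⇒character : IsCharacter (lookup B)
    largestSumFree⇒character = sumFree-halfsize⇒character (proj₁ B-largest)
      (subst (_≤ count (lookup B) + count (lookup B)) (count-character χ-hom χg)
             (+-mono-≤ character≤largest character≤largest))

  evenOrder⇒involution : 2 ∣ n → ∃ λ a → a ≢ ε × a ∙ a ≡ ε
  evenOrder⇒involution 2∣n =
    let a , a≢ε , a⁻¹≡a = involution-secondFixedPoint _⁻¹ ⁻¹-involutive 2∣n ε ε⁻¹≈ε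
    in a , a≢ε , trans (cong (a ∙_) (sym a⁻¹≡a)) (inverseʳ a)

  evenOrder⇒nonDouble : 2 ∣ n → ∃ λ g → ∀ y → y ∙ y ≢ g
  evenOrder⇒nonDouble 2∣n =
    let a , a≢ε , a∙a≡ε = evenOrder⇒involution 2∣n
    in collision⇒missed (λ y → y ∙ y) a ε a≢ε (trans a∙a≡ε (sym (identityˡ ε)))

  record ProperSubgroup⊇Doubles : Set where
    field
      member    : Fin n → Bool
      ∙-closed  : ∀ {x y} → member x ≡ true → member y ≡ true → member (x ∙ y) ≡ true
      doubles   : ∀ x → member (x ∙ x) ≡ true
      outsider  : Fin n
      outsider∉ : member outsider ≡ false

    private
      g = outsider

      member-resp : ∀ {x y} → x ≡ y → member x ≡ true → member y ≡ true
      member-resp = subst (λ z → member z ≡ true)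

    ⁻¹-closed : ∀ {y} → member y ≡ true → member (y ⁻¹) ≡ true
    ⁻¹-closed {y} y∈ = member-resp y∙y⁻¹²≡y⁻¹ (∙-closed y∈ (doubles (y ⁻¹)))
      where
      y∙y⁻¹²≡y⁻¹ : y ∙ (y ⁻¹ ∙ y ⁻¹) ≡ y ⁻¹
      y∙y⁻¹²≡y⁻¹ = trans (sym (assoc y (y ⁻¹) (y ⁻¹)))
                         (trans (cong (_∙ y ⁻¹) (inverseʳ y)) (identityˡ (y ⁻¹)))

    ∙⁻¹-closed : ∀ {x y} → member (x ∙ y) ≡ true → member y ≡ true → member x ≡ true
    ∙⁻¹-closed {x} {y} x∙y∈ y∈ = member-resp (∙∙⁻¹ x y) (∙-closed x∙y∈ (⁻¹-closed y∈))

    coset-product : ∀ {x y} → member (x ∙ g) ≡ true → member (y ∙ g) ≡ true → member (x ∙ y) ≡ true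
    coset-product {x} {y} x∙g∈ y∙g∈ =
      member-resp decomposition (∙-closed (∙-closed x∙g∈ y∙g∈) (doubles (g ⁻¹)))
      where
      decomposition : x ∙ g ∙ (y ∙ g) ∙ (g ⁻¹ ∙ g ⁻¹) ≡ x ∙ y
      decomposition =
        trans (interchange (x ∙ g) (y ∙ g) (g ⁻¹) (g ⁻¹)) (cong₂ _∙_ (∙∙⁻¹ x g) (∙∙⁻¹ y g))

    complement-character : (∀ x → member x ∨ member (x ∙ g) ≡ true) → IsCharacter (not ∘ member)
    complement-character covers x y with member x in x∈ | member y in y∈
    ... | true | true = cong not (∙-closed x∈ y∈)
    ... | true | false = cong not (contraposeᵇ (λ x∙y∈ → ∙⁻¹-closed (member-resp (comm x y) x∙y∈) x∈) y∈)
    ... | false | true = cong not (contraposeᵇ (λ x∙y∈ → ∙⁻¹-closed x∙y∈ y∈) x∈)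
    ... | false | false = cong not (coset-product (coset x x∈) (coset y y∈))
      where
      coset : ∀ z → member z ≡ false → member (z ∙ g) ≡ true
      coset z z∉ with ∨≡true⁻ _ _ (covers z)
      ... | inj₁ z∈ with () ← trans (sym z∈) z∉
      ... | inj₂ z∙g∈ = z∙g∈

    adjoin : ∀ z → member z ∨ member (z ∙ g) ≡ false → ProperSubgroup⊇Doubles
    adjoin z z∉ = record
      { member = λ x → member x ∨ member (x ∙ g)
      ; ∙-closed = λ {x} {y} → ∨-closed x y
      ; doubles = λ x → ∨≡true⁺ˡ _ (doubles x)
      ; outsider = z
      ; outsider∉ = z∉
      }
      where
      ∨-closed : ∀ x y → member x ∨ member (x ∙ g) ≡ true → member y ∨ member (y ∙ g) ≡ true
               → member (x ∙ y) ∨ member (x ∙ y ∙ g) ≡ true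
      ∨-closed x y x∈′ y∈′ with ∨≡true⁻ _ _ x∈′ | ∨≡true⁻ _ _ y∈′
      ... | inj₁ x∈ | inj₁ y∈ = ∨≡true⁺ˡ _ (∙-closed x∈ y∈)
      ... | inj₁ x∈ | inj₂ y∙g∈ = ∨≡true⁺ʳ _ (member-resp (sym (assoc x y g)) (∙-closed x∈ y∙g∈))
      ... | inj₂ x∙g∈ | inj₁ y∈ = ∨≡true⁺ʳ _ (member-resp (xy∙z≈xz∙y x g y) (∙-closed x∙g∈ y∈))
      ... | inj₂ x∙g∈ | inj₂ y∙g∈ = ∨≡true⁺ˡ _ (coset-product x∙g∈ y∙g∈)

    count<n : count member < n
    count<n = subst (count member <_) (count-complement member)
      (m<m+n (count member) (count-positive (not ∘ member) g (cong not outsider∉)))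

  open ProperSubgroup⊇Doubles using (member; outsider; outsider∉; adjoin; complement-character; count<n)

  adjoin-grows : (H : ProperSubgroup⊇Doubles) → ∀ z z∉ → count (member H) < count (member (adjoin H z z∉))
  adjoin-grows H z z∉ = count-strict-mono _ _ (λ x x∈ → ∨≡true⁺ˡ _ x∈) (outsider H)
    (∨≡true⁺ʳ _ (ProperSubgroup⊇Doubles.doubles H (outsider H))) (outsider∉ H)

  subgroup⇒nontrivialCharacter : (k : ℕ) (H : ProperSubgroup⊇Doubles)
    → n ≤ count (member H) + k → NontrivialCharacter
  subgroup⇒nontrivialCharacter zero H n≤ = ⊥-elim (<⇒≱ (count<n H) (subst (n ≤_) (+-identityʳ _) n≤))
  subgroup⇒nontrivialCharacter (suc k) H n≤ with all? (λ x → member H x ∨ member H (x ∙ outsider H) ≟ true)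
  ... | yes covers = record
    { χ = not ∘ member H ; χ-hom = complement-character H covers ; g = outsider H ; χg = cong not (outsider∉ H) }
  ... | no ¬covers = subgroup⇒nontrivialCharacter k (adjoin H z z∉)
        (≤-trans n≤ (≤-trans (≤-reflexive (+-suc _ k)) (+-monoˡ-≤ k (adjoin-grows H z z∉))))
    where
    uncovered = ¬∀⟶∃¬ n _ (λ x → member H x ∨ member H (x ∙ outsider H) ≟ true) ¬covers
    z = proj₁ uncovered
    z∉ = ¬-not (proj₂ uncovered)

  doublesSubgroup : ∀ g → (∀ y → y ∙ y ≢ g) → ProperSubgroup⊇Doubles
  doublesSubgroup g g-nonDouble = record
    { member = isDouble
    ; ∙-closed = ∙-closed
    ; doubles = λ x → dec-true (any? _) (x , refl)
    ; outsider = g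
    ; outsider∉ = dec-false (any? _) (λ (y , y²≡g) → g-nonDouble y y²≡g)
    }
    where
    isDouble : Fin n → Bool
    isDouble x = does (any? (λ y → y ∙ y Fin.≟ x))
    ∙-closed : ∀ {x y} → isDouble x ≡ true → isDouble y ≡ true → isDouble (x ∙ y) ≡ true
    isDouble⁻ : ∀ {x} → isDouble x ≡ true → ∃ λ a → a ∙ a ≡ x
    isDouble⁻ {x} x∈ with any? (λ y → y ∙ y Fin.≟ x)
    ... | yes found = found
    ∙-closed x∈ y∈ =
      let a , a²≡x = isDouble⁻ x∈
          b , b²≡y = isDouble⁻ y∈
      in dec-true (any? _) (a ∙ b , trans (interchange a b a b) (cong₂ _∙_ a²≡x b²≡y))

  evenOrder⇒nontrivialCharacter : 2 ∣ n → NontrivialCharacter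
  evenOrder⇒nontrivialCharacter 2∣n =
    let g , g-nonDouble = evenOrder⇒nonDouble 2∣n
    in subgroup⇒nontrivialCharacter n (doublesSubgroup g g-nonDouble) (m≤n+m n _)

  module IndependentCharacters {t : ℕ} (B : Fin t → Subset n)
    (B-character : ∀ i → IsCharacter (lookup (B i))) (B-independent : Independent B) where

    χ : Fin t → Fin n → Bool
    χ i = lookup (B i)

    dual : Fin t → Fin n
    dual i = proj₁ (independent⇒separated B B-independent i)

    χ-dual-self : ∀ i → χ i (dual i) ≡ true
    χ-dual-self i = proj₁ (proj₂ (independent⇒separated B B-independent i))

    χ-dual-other : ∀ i j → j ≢ i → χ j (dual i) ≡ false
    χ-dual-other i = proj₂ (proj₂ (independent⇒separated B B-independent i))

    combination : (Fin t → Bool) → Fin n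
    combination s = ∑ (λ i → if s i then dual i else ε)

    character-combination : ∀ {ψ} → IsCharacter ψ → ∀ s
      → ψ (combination s) ≡ xorSum (λ i → s i ∧ ψ (dual i))
    character-combination {ψ} ψ-hom s = trans (character-∑ {ψ} ψ-hom (λ i → if s i then dual i else ε))
                                              (xorSum-cong (λ i → character-if {ψ} ψ-hom (s i) (dual i)))

    χ-combination : ∀ s j → χ j (combination s) ≡ s j
    χ-combination s j = begin
      χ j (combination s)                   ≡⟨ character-combination {χ j} (B-character j) s ⟩
      xorSum (λ i → s i ∧ χ j (dual i))     ≡⟨ xorSum-δ _ j off-diagonal ⟩
      s j ∧ χ j (dual j)                    ≡⟨ cong (s j ∧_) (χ-dual-self j) ⟩
      s j ∧ true                            ≡⟨ ∧-identityʳ (s j) ⟩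
      s j                                   ∎
      where
      open ≡-Reasoning
      off-diagonal : ∀ i → i ≢ j → s i ∧ χ j (dual i) ≡ false
      off-diagonal i i≢j = trans (cong (s i ∧_) (χ-dual-other i j (i≢j ∘ sym))) (∧-zeroʳ (s i))

    -- y and the combination of its coordinates differ by an element outside every B i
    expansion : ∀ {ψ} → IsCharacter ψ → (∀ y → ψ y ≡ true → ∃ λ i → χ i y ≡ true)
      → ∀ s y → (∀ i → χ i y ≡ s i) → ψ y ≡ ψ (combination s)
    expansion {ψ} ψ-hom ψ⊆⋃B s y y-coordinates = begin
      ψ y                       ≡⟨ cong ψ (∙⁻¹∙ y c) ⟨
      ψ (y ∙ c ⁻¹ ∙ c)          ≡⟨ ψ-hom (y ∙ c ⁻¹) c ⟩
      ψ (y ∙ c ⁻¹) xor ψ c      ≡⟨ cong (_xor ψ c) remainder∉ψ ⟩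
      ψ c                       ∎
      where
      open ≡-Reasoning
      c = combination s
      remainder∉B : ∀ i → χ i (y ∙ c ⁻¹) ≡ false
      remainder∉B i = trans (character-∙⁻¹ {χ i} (B-character i) y c)
        (trans (cong₂ _xor_ (y-coordinates i) (χ-combination s i)) (xor-same (s i)))
      remainder∉ψ : ψ (y ∙ c ⁻¹) ≡ false
      remainder∉ψ with ψ (y ∙ c ⁻¹) in r∈ψ
      ... | false = refl
      ... | true with ψ⊆⋃B _ r∈ψ
      ...   | i , r∈Bi with () ← trans (sym r∈Bi) (remainder∉B i)

    translate-dual : ∀ i j → j ≢ i → ∀ y → χ j (y ∙ dual i) ≡ χ j y
    translate-dual i j j≢i y =
      trans (B-character j y (dual i)) (trans (cong (χ j y xor_) (χ-dual-other i j j≢i)) (xor-identityʳ (χ j y)))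

    partialAtom : (Fin t → Bool) → List (Fin t) → Fin n → Bool
    partialAtom s L = lookup (⋂ (List.map (λ i → power B (s i) (B i)) L))

    partialAtom-∷ : ∀ s i L y → partialAtom s (i ∷ L) y ≡ lookup (power B (s i) (B i)) y ∧ partialAtom s L y
    partialAtom-∷ s i L y = lookup-zipWith _∧_ y (power B (s i) (B i)) (⋂ (List.map (λ j → power B (s j) (B j)) L))

    partialAtom-invariant : ∀ s L i → All (i ≢_) L → ∀ y → partialAtom s L (y ∙ dual i) ≡ partialAtom s L y
    partialAtom-invariant s [] i [] y = trans (lookup-replicate (y ∙ dual i) true) (sym (lookup-replicate y true))
    partialAtom-invariant s (j ∷ L) i (i≢j ∷ i∉L) y = begin
      partialAtom s (j ∷ L) (y ∙ dual i)                                        ≡⟨ partialAtom-∷ s j L _ ⟩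
      lookup (power B (s j) (B j)) (y ∙ dual i) ∧ partialAtom s L (y ∙ dual i)  ≡⟨ cong₂ _∧_
                                   (lookup-power-cong B (s j) (B j) (translate-dual i j (i≢j ∘ sym) y))
                                   (partialAtom-invariant s L i i∉L y) ⟩
      lookup (power B (s j) (B j)) y ∧ partialAtom s L y                        ≡⟨ partialAtom-∷ s j L y ⟨
      partialAtom s (j ∷ L) y                                                   ∎
      where open ≡-Reasoning

    count-partialAtom : ∀ s L → Unique L → count (partialAtom s L) * 2 ^ List.length L ≡ n
    count-partialAtom s [] [] = trans (*-identityʳ (count (partialAtom s [])))
      (trans (count-cong {n} (λ y → lookup-replicate y true)) (count-true n))
    count-partialAtom s (i ∷ L) (i∉L ∷ L-unique) = begin
      count (partialAtom s (i ∷ L)) * (2 * 2 ^ List.length L)  ≡⟨ *-assoc (count (partialAtom s (i ∷ L))) 2 _ ⟨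
      count (partialAtom s (i ∷ L)) * 2 * 2 ^ List.length L    ≡⟨ cong (_* 2 ^ List.length L) halving ⟩
      count (partialAtom s L) * 2 ^ List.length L              ≡⟨ count-partialAtom s L L-unique ⟩
      n                                                        ∎
      where
      open ≡-Reasoning
      halving : count (partialAtom s (i ∷ L)) * 2 ≡ count (partialAtom s L)
      halving = trans (cong (_* 2) (count-cong (partialAtom-∷ s i L)))
        (count-halving (partialAtom s L) (lookup (power B (s i) (B i))) (dual i) (partialAtom-invariant s L i i∉L)
          (λ y → lookup-power-not B (s i) (B i) (character-translate (B-character i) (χ-dual-self i) y)))

    count-atom : ∀ s → ∣ atom B s ∣ * 2 ^ t ≡ n
    count-atom s = trans (cong (_* 2 ^ t) (∣p∣≡count (atom B s)))
      (subst (λ k → count (partialAtom s (allFin t)) * 2 ^ k ≡ n) (length-tabulate {n = t} id)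
             (count-partialAtom s (allFin t) (allFin⁺ t)))

    label : Subset n → Subset t
    label C = tabulate (λ i → lookup C (dual i))

    label-B : ∀ i → label (B i) ≡ ⁅ i ⁆
    label-B i = lookup-ext λ j → trans (lookup∘tabulate _ j) (χ-dual-δ j)
      where
      χ-dual-δ : ∀ j → χ i (dual j) ≡ lookup ⁅ i ⁆ j
      χ-dual-δ j with j Fin.≟ i
      ... | yes refl = trans (χ-dual-self i) (sym ([]=⇒lookup (x∈⁅x⁆ i)))
      ... | no j≢i = trans (χ-dual-other j i (j≢i ∘ sym))
                           (sym (¬-not (j≢i ∘ x∈⁅y⁆⇒x≡y i ∘ lookup⇒[]= j ⁅ i ⁆)))

    label-surjective : ∀ S → Nonempty S → ∃ λ C → LargestSumFree _∙_ C × C ⊆ UnionAll B × label C ≡ S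
    label-surjective S (k , k∈S) =
      tabulate ψ , character⇒largestSumFree ψ-hom ψ-dual-k , ψ⊆⋃B ,
      lookup-ext (λ j → trans (lookup∘tabulate _ j) (trans (lookup∘tabulate ψ (dual j)) (ψ-dual j)))
      where
      ψ : Fin n → Bool
      ψ y = xorSum (λ i → lookup S i ∧ χ i y)
      ψ-hom : IsCharacter ψ
      ψ-hom x y = trans
        (xorSum-cong (λ i → trans (cong (lookup S i ∧_) (B-character i x y)) (∧-distribˡ-xor (lookup S i) _ _)))
        (xorSum-xor (λ i → lookup S i ∧ χ i x) (λ i → lookup S i ∧ χ i y))
      ψ-dual : ∀ j → ψ (dual j) ≡ lookup S j
      ψ-dual j = trans (xorSum-δ _ j (λ i i≢j → trans (cong (lookup S i ∧_) (χ-dual-other j i i≢j)) (∧-zeroʳ _)))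
                       (trans (cong (lookup S j ∧_) (χ-dual-self j)) (∧-identityʳ _))
      ψ-dual-k : ψ (dual k) ≡ true
      ψ-dual-k = trans (ψ-dual k) ([]=⇒lookup k∈S)
      ψ⊆⋃B : tabulate ψ ⊆ UnionAll B
      ψ⊆⋃B y∈ψ = let i , i∈S∧y∈Bi = xorSum-witness _ (∈-tabulate⁻ y∈ψ)
                 in ∈UnionAll⁺ B i (lookup⇒[]= _ (B i) (∧≡true⁻ʳ _ i∈S∧y∈Bi))

    module _ (nontrivial : NontrivialCharacter) {C : Subset n}
             (C-largest : LargestSumFree _∙_ C) (C⊆⋃B : C ⊆ UnionAll B) where

      private
        C-character : IsCharacter (lookup C)
        C-character = largestSumFree⇒character nontrivial C-largest

        C⊆⋃χ : ∀ y → lookup C y ≡ true → ∃ λ i → χ i y ≡ true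
        C⊆⋃χ y y∈C = let i , y∈Bi = ∈UnionAll⁻ B (C⊆⋃B (lookup⇒[]= y C y∈C)) in i , []=⇒lookup y∈Bi

      largest-expansion : ∀ s y → (∀ i → χ i y ≡ s i) → lookup C y ≡ xorSum (λ i → s i ∧ lookup C (dual i))
      largest-expansion s y y-coordinates =
        trans (expansion C-character C⊆⋃χ s y y-coordinates) (character-combination {lookup C} C-character s)

      label-nonempty : Nonempty (label C)
      label-nonempty =
        let b , b∈C = largestSumFree⇒nonempty nontrivial C-largest
            i , i∈ = xorSum-witness _ (trans (sym (largest-expansion _ b (λ _ → refl))) b∈C)
        in i , ∈-tabulate⁺ (∧≡true⁻ʳ _ i∈)

      atom⊆⇔odd : ∀ s → atom B s ⊆ C ⇔ Odd ∣ label C ∩ tabulate s ∣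
      atom⊆⇔odd s = mk⇔
        (λ atom⊆C → Equivalence.from odd⇔
          (trans (sym (value-on-atom combination∈atom)) ([]=⇒lookup (atom⊆C combination∈atom))))
        (λ odd {y} y∈atom → lookup⇒[]= y C (trans (value-on-atom y∈atom) (Equivalence.to odd⇔ odd)))
        where
        value-on-atom : ∀ {y} → y ∈ atom B s → lookup C y ≡ xorSum (λ i → s i ∧ lookup C (dual i))
        value-on-atom {y} y∈atom = largest-expansion s y (Equivalence.to (∈atom⇔ B s) y∈atom)
        combination∈atom : combination s ∈ atom B s
        combination∈atom = Equivalence.from (∈atom⇔ B s) (χ-combination s)
        odd⇔ : Odd ∣ label C ∩ tabulate s ∣ ⇔ xorSum (λ i → s i ∧ lookup C (dual i)) ≡ true
        odd⇔ = subst (λ b → Odd ∣ label C ∩ tabulate s ∣ ⇔ b ≡ true)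
          (xorSum-cong (λ i → trans (cong₂ _∧_ (lookup∘tabulate _ i) (lookup∘tabulate s i)) (∧-comm _ (s i))))
          (Odd∣p∩q∣⇔ (label C) (tabulate s))

    label-injective : NontrivialCharacter → ∀ C D → LargestSumFree _∙_ C → C ⊆ UnionAll B
      → LargestSumFree _∙_ D → D ⊆ UnionAll B → label C ≡ label D → C ≡ D
    label-injective nontrivial C D C-largest C⊆⋃B D-largest D⊆⋃B labels≡ = lookup-ext λ y → begin
      lookup C y                                ≡⟨ largest-expansion nontrivial C-largest C⊆⋃B _ y (λ _ → refl) ⟩
      xorSum (λ i → χ i y ∧ lookup C (dual i))  ≡⟨ xorSum-cong (λ i → cong (χ i y ∧_) (same-labels i)) ⟩
      xorSum (λ i → χ i y ∧ lookup D (dual i))  ≡⟨ largest-expansion nontrivial D-largest D⊆⋃B _ y (λ _ → refl) ⟨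
      lookup D y                                ∎
      where
      open ≡-Reasoning
      same-labels : ∀ i → lookup C (dual i) ≡ lookup D (dual i)
      same-labels i = trans (sym (lookup∘tabulate _ i)) (trans (cong (λ p → lookup p i) labels≡) (lookup∘tabulate _ i))

corollary3p11 : (n : ℕ) (_+_ : Fin n → Fin n → Fin n) (0# : Fin n) (-_ : Fin n → Fin n)
    → IsAbelianGroup _≡_ _+_ 0# -_
    → 2 ∣ n
    → (t : ℕ) → 2 ≤ t
    → (B : Fin t → Subset n)
    → (∀ i → LargestSumFree _+_ (B i))
    → Independent B
    → ((ε : Fin t → Bool) → ∣ atom B ε ∣ * 2 ^ t ≡ n)
      × (Σ (Subset n → Subset t) λ I →
          (∀ C → LargestSumFree _+_ C → C ⊆ UnionAll B → Nonempty (I C))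
          × (∀ C D → LargestSumFree _+_ C → C ⊆ UnionAll B
                   → LargestSumFree _+_ D → D ⊆ UnionAll B → I C ≡ I D → C ≡ D)
          × (∀ S → Nonempty S → ∃ λ C → LargestSumFree _+_ C × C ⊆ UnionAll B × I C ≡ S)
          × (∀ i → I (B i) ≡ ⁅ i ⁆)
          × (∀ C → LargestSumFree _+_ C → C ⊆ UnionAll B → (ε : Fin t → Bool)
               → (atom B ε ⊆ C ⇔ Odd ∣ I C ∩ tabulate ε ∣)))
corollary3p11 n _+_ 0# -_ isAbelianGroup 2∣n t _ B B-largest B-independent =
  count-atom , label ,
  (λ C → label-nonempty nontrivial {C}) ,
  label-injective nontrivial ,
  label-surjective ,
  label-B ,
  (λ C → atom⊆⇔odd nontrivial {C})
  where
  open SumFreeSets isAbelianGroup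
  nontrivial : NontrivialCharacter
  nontrivial = evenOrder⇒nontrivialCharacter 2∣n
  open IndependentCharacters B (λ i → largestSumFree⇒character nontrivial (B-largest i)) B-independent
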